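{- Let $\mathcal{C}$ be a category with binary products and $\mathcal{E}$ a class of morphisms of $\mathcal{C}$. Let $\mathcal{P}$ be the full subcategory of $\mathcal{C}$ on the $\mathcal{E}$-projective objects. If $\mathcal{P}'$ is a full subcategory of $\mathcal{P}$ closed under binary products such that every object of $\mathcal{P}$ is the codomain of an arrow in $\mathcal{E}$ whose domain is in $\mathcal{P}'$, then $\mathcal{P}$ is closed under binary products.
   Context: An object $X$ is $\mathcal{E}$-projective if for every arrow $s:Y\to A$ in $\mathcal{E}$ and every arrow $f:X\to A$ there is $k:X\to Y$ with $sk=f$. -}

module Defs where

open import Level using (Level; _⊔_; suc)
open import Relation.Binary using (IsEquivalence)
open import Data.Product using (Σ; _×_; _,_)

record Category (o ℓ e : Level) : Set (suc (o ⊔ ℓ ⊔ e)) where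
  infixr 9 _∘_
  infix  4 _≈_
  field
    Obj   : Set o
    Hom   : Obj → Obj → Set ℓ
    _≈_   : ∀ {A B} → Hom A B → Hom A B → Set e
    id    : ∀ {A} → Hom A A
    _∘_   : ∀ {A B C} → Hom B C → Hom A B → Hom A C
    ≈-equiv   : ∀ {A B} → IsEquivalence (_≈_ {A} {B})
    ∘-resp-≈  : ∀ {A B C} {f h : Hom B C} {g i : Hom A B} →
                f ≈ h → g ≈ i → f ∘ g ≈ h ∘ i
    assoc     : ∀ {A B C D} {f : Hom A B} {g : Hom B C} {h : Hom C D} →
                (h ∘ g) ∘ f ≈ h ∘ (g ∘ f)
    identityˡ : ∀ {A B} {f : Hom A B} → id ∘ f ≈ f
    identityʳ : ∀ {A B} {f : Hom A B} → f ∘ id ≈ f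

record BinaryProducts {o ℓ e} (C : Category o ℓ e) : Set (o ⊔ ℓ ⊔ e) where
  open Category C
  infixr 7 _⊗_
  field
    _⊗_   : Obj → Obj → Obj
    π₁    : ∀ {A B} → Hom (A ⊗ B) A
    π₂    : ∀ {A B} → Hom (A ⊗ B) B
    ⟨_,_⟩ : ∀ {X A B} → Hom X A → Hom X B → Hom X (A ⊗ B)
    project₁ : ∀ {X A B} {f : Hom X A} {g : Hom X B} → π₁ ∘ ⟨ f , g ⟩ ≈ f
    project₂ : ∀ {X A B} {f : Hom X A} {g : Hom X B} → π₂ ∘ ⟨ f , g ⟩ ≈ g
    unique   : ∀ {X A B} {h : Hom X (A ⊗ B)} {f : Hom X A} {g : Hom X B} →
               π₁ ∘ h ≈ f → π₂ ∘ h ≈ g → ⟨ f , g ⟩ ≈ h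

module _ {o ℓ e} (C : Category o ℓ e) where
  open Category C

  MorClass : (r : Level) → Set (o ⊔ ℓ ⊔ suc r)
  MorClass r = ∀ {A B} → Hom A B → Set r

  Projective : ∀ {r} → MorClass r → Obj → Set (o ⊔ ℓ ⊔ e ⊔ r)
  Projective E X = ∀ {Y A} (s : Hom Y A) → E s → (f : Hom X A) →
                   Σ (Hom X Y) λ k → s ∘ k ≈ f

{-# OPTIONS --safe #-}
module Submission where

-- Since X is projective, an E-cover X′ → X with X′ in P′ splits, so X is a
-- retract of X′. Products of retractions are retractions, so X ⊗ Y is a
-- retract of X′ ⊗ Y′, which lies in P′ and is therefore projective; and a
-- retract of a projective object is projective.

open import Defs
open import Level using (_⊔_)
open import Data.Product using (Σ; _×_; _,_)
open import Relation.Binary using (IsEquivalence)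

module _ {o ℓ e} (C : Category o ℓ e) where
  open Category C
  private
    module Eq {A B} = IsEquivalence (≈-equiv {A} {B})

    infixr 5 _⟩≈⟨_
    _⟩≈⟨_ : ∀ {A B} {f g h : Hom A B} → f ≈ g → g ≈ h → f ≈ h
    _⟩≈⟨_ = Eq.trans

    cancelʳ : ∀ {A B D} {f : Hom A D} {r : Hom B A} {i : Hom A B} →
              r ∘ i ≈ id → (f ∘ r) ∘ i ≈ f
    cancelʳ r∘i≈id = assoc ⟩≈⟨ ∘-resp-≈ Eq.refl r∘i≈id ⟩≈⟨ identityʳ

    cancel-through : ∀ {A B A′ B′} {p : Hom A B} {p′ : Hom A′ B′}
                       {R : Hom A′ A} {I : Hom A A′} {r : Hom B′ B} {i : Hom B B′} →
                     p ∘ R ≈ r ∘ p′ → p′ ∘ I ≈ i ∘ p → r ∘ i ≈ id → p ∘ (R ∘ I) ≈ p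
    cancel-through p∘R≈r∘p′ p′∘I≈i∘p r∘i≈id =
      Eq.sym assoc ⟩≈⟨ ∘-resp-≈ p∘R≈r∘p′ Eq.refl ⟩≈⟨ assoc
      ⟩≈⟨ ∘-resp-≈ Eq.refl p′∘I≈i∘p ⟩≈⟨ Eq.sym assoc
      ⟩≈⟨ ∘-resp-≈ r∘i≈id Eq.refl ⟩≈⟨ identityˡ

  record Retract (A B : Obj) : Set (ℓ ⊔ e) where
    field
      retraction : Hom A B
      section    : Hom B A
      retract    : retraction ∘ section ≈ id

  projective-cover-splits : ∀ {r} {E : MorClass C r} {X′ X} (s : Hom X′ X) →
                            E s → Projective C E X → Retract X′ X
  projective-cover-splits s s∈E pX with pX s s∈E id
  ... | i , s∘i≈id = record { retraction = s ; section = i ; retract = s∘i≈id }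

  retract-projective : ∀ {r} {E : MorClass C r} {A B} → Retract A B →
                       Projective C E A → Projective C E B
  retract-projective ρ pA s s∈E f with pA s s∈E (f ∘ Retract.retraction ρ)
  ... | k , s∘k≈f∘r = k ∘ section , s∘k∘i≈f
    where
    open Retract ρ
    s∘k∘i≈f : s ∘ (k ∘ section) ≈ f
    s∘k∘i≈f = Eq.sym assoc ⟩≈⟨ ∘-resp-≈ s∘k≈f∘r Eq.refl ⟩≈⟨ cancelʳ retract

  module _ (prod : BinaryProducts C) where
    open BinaryProducts prod

    infixr 8 _⁂_
    _⁂_ : ∀ {A A′ B B′} → Hom A B → Hom A′ B′ → Hom (A ⊗ A′) (B ⊗ B′)
    f ⁂ g = ⟨ f ∘ π₁ , g ∘ π₂ ⟩

    ⁂-retract : ∀ {A A′ B B′} {r : Hom A B} {r′ : Hom A′ B′} {i : Hom B A} {i′ : Hom B′ A′} →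
                r ∘ i ≈ id → r′ ∘ i′ ≈ id → (r ⁂ r′) ∘ (i ⁂ i′) ≈ id
    ⁂-retract r∘i≈id r′∘i′≈id =
      Eq.sym (unique (cancel-through project₁ project₁ r∘i≈id)
                     (cancel-through project₂ project₂ r′∘i′≈id))
      ⟩≈⟨ unique identityʳ identityʳ

    ⊗-Retract : ∀ {A A′ B B′} → Retract A B → Retract A′ B′ → Retract (A ⊗ A′) (B ⊗ B′)
    ⊗-Retract ρ σ = record
      { retraction = Retract.retraction ρ ⁂ Retract.retraction σ
      ; section    = Retract.section ρ ⁂ Retract.section σ
      ; retract    = ⁂-retract (Retract.retract ρ) (Retract.retract σ)
      }

lemma6p1 : ∀ {o ℓ e r p} (C : Category o ℓ e) (prod : BinaryProducts C)
             (E : MorClass C r) (P′ : Category.Obj C → Set p) →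
             (∀ X → P′ X → Projective C E X) →
             (∀ X Y → P′ X → P′ Y → P′ (BinaryProducts._⊗_ prod X Y)) →
             (∀ X → Projective C E X →
                Σ (Category.Obj C) λ X′ → Σ (Category.Hom C X′ X) λ s → P′ X′ × E s) →
             ∀ X Y → Projective C E X → Projective C E Y →
             Projective C E (BinaryProducts._⊗_ prod X Y)
lemma6p1 C prod E P′ P′⇒projective P′-⊗ cover X Y pX pY
  with cover X pX | cover Y pY
... | X′ , s , P′X′ , s∈E | Y′ , t , P′Y′ , t∈E =
  retract-projective C
    (⊗-Retract C prod (projective-cover-splits C s s∈E pX)
                      (projective-cover-splits C t t∈E pY))
    (P′⇒projective (X′ ⊗ Y′) (P′-⊗ X′ Y′ P′X′ P′Y′))
  where open BinaryProducts prod using (_⊗_)
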